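{- Let $R\ge 2$, let $S$ be an $R$-fold rotationally symmetric connected unpseudoknotted secondary structure with strand ordering $\pi$, and let $\mathcal{C}^b_R$ be an admissible $R$-symmetric backbone cut of $S$ generated by a covalent bond $b$. Let $G$ be the graph obtained from $\mathrm{Poly}(S,\pi)$ by removing the covalent bonds of $\mathcal{C}^b_R$, i.e. $G=(V(\mathrm{Poly}(S,\pi)),E(\mathrm{Poly}(S,\pi))\setminus\mathcal{C}^b_R)$. Then $G$ is disconnected and consists of exactly $R$ connected components, which are pairwise isomorphic.
   Context: Strands are words over $\{\mathrm{A},\mathrm{C},\mathrm{G},\mathrm{T}\}$; strands with identical sequences have the same type. A circular strand ordering $\pi$ is a cyclic string over strand types; $v(\pi)$ is the largest $n$ with $\pi=y^n$ for a prefix $y$; the shortest such prefix is the fundamental component, and $X^n_m$ denotes the $m$-th strand of type $X$ in its $n$-th copy. The $N$ bases are indexed $1,\dots,N$ around a circle in the order $\pi$ (each strand $5'\to3'$). A secondary structure $S$ is a set of base pairs $(i,j)$, each base in at most one pair; the polymer graph $\mathrm{Poly}(S,\pi)$ has the bases as vertices and as edges the covalent bonds (between consecutive bases $i,i+1$ of the same strand; nicks between strands are not bonds) and the base pairs (drawn as chords). $S$ is unpseudoknotted (for $\pi$) if no two chords cross and connected if $\mathrm{Poly}(S,\pi)$ is connected. Let $\rho$ send base $i$ of strand $X^n_m$ to base $i$ of $X^{n+1\bmod v(\pi)}_m$ and $G^\pi=\langle\rho\rangle$. $S$ is $R$-fold rotationally symmetric if the largest subgroup $H\le G^\pi$ such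 that $(i,j)\in S\iff(a(i),a(j))\in S$ for all $a\in H$ has $|H|=R$. For a covalent bond $b$ and $H$ the subgroup of $G^\pi$ of order $R$, $\mathcal{C}^b_R=\{a(b):a\in H\}$. With $l[i,j]=\min\{|i-j|+1,N-|i-j|+1\}$ and $[\![i,j]\!]$ the shorter arc between $i$ and $j$, the cut $\mathcal{C}^b_R$ is admissible for $S$ if no $x\in\mathcal{C}^b_R$ is contained in $[\![i,j]\!]$ for any base pair $(i,j)\in S$. -}

module Defs where

open import Data.Nat using (ℕ; zero; suc; _+_; _*_; _∸_; _≤_; _<_; ∣_-_∣; _⊓_; _⊔_)
open import Data.Nat.DivMod using (_%_)
open import Data.List using (List; []; _∷_; length; map; concat; replicate)
open import Data.Nat.ListAction using (sum)
open import Data.Unit using (⊤)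
open import Data.List.Membership.Propositional using (_∈_)
open import Data.Product using (Σ; _×_; _,_)
open import Data.Sum using (_⊎_)
open import Data.Empty using (⊥)
open import Data.Fin using (Fin; toℕ)
open import Data.Fin.Subset using (Subset; ∣_∣) renaming (_∈_ to _∈ₛ_)
open import Relation.Nullary using (¬_)
open import Relation.Binary.PropositionalEquality using (_≡_)
open import Relation.Binary.Construct.Closure.ReflexiveTransitive using (Star)
open import Function.Bundles using (_⇔_)

data Nuc : Set where
  A C G T : Nuc

-- A strand is a word over {A,C,G,T}; two strands have the same type iff
-- their sequences are equal (so the type of a strand is its sequence).
Strand : Set
Strand = List Nuc

-- A circular strand ordering, given by a linear representative.
Ordering : Set
Ordering = List Strand

nBases : Ordering → ℕ
nBases π = sum (map length π)

record Periodicity (π : Ordering) : Set where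
  field
    v     : ℕ
    fund  : Ordering
    rep   : π ≡ concat (replicate v fund)
    vmax  : ∀ n y → π ≡ concat (replicate n y) → n ≤ v

-- x mod n (with x mod 0 = x; irrelevant since N = 0 means no bases)
_mod_ : ℕ → ℕ → ℕ
x mod zero    = x
x mod (suc n) = x % suc n

-- Bases are indexed 0,…,N-1 (the paper's 1,…,N shifted by one) around
-- the circle in the order π, each strand 5'→3'.
-- IsBond π k : bases k and k+1 lie in the same strand, i.e. there is a
-- covalent bond {k, k+1}; the bond is identified with its index k.
-- (Nicks between strands, including the one between base N-1 and base 0,
-- are not bonds.)
IsBond : Ordering → ℕ → Set
IsBond []      k = ⊥
IsBond (s ∷ π) k = (suc k < length s) ⊎ (length s ≤ k × IsBond π (k ∸ length s))

SecStr : Set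
SecStr = List (ℕ × ℕ)

BP : SecStr → ℕ → ℕ → Set
BP S i j = ((i , j) ∈ S) ⊎ ((j , i) ∈ S)

IsSecStr : Ordering → SecStr → Set
IsSecStr π S =
  (∀ i j → (i , j) ∈ S → i < nBases π × j < nBases π × ¬ (i ≡ j)) ×
  (∀ i j k → BP S i j → BP S i k → j ≡ k)

Unpseudoknotted : SecStr → Set
Unpseudoknotted S = ∀ i j k l → BP S i j → BP S k l → ¬ (i < k × k < j × j < l)

Connected-in : (ℕ → ℕ → Set) → ℕ → ℕ → Set
Connected-in Adj = Star Adj

IsConnectedGraph : ℕ → (ℕ → ℕ → Set) → Set
IsConnectedGraph N Adj = ∀ i j → i < N → j < N → Connected-in Adj i j

CovEdge : Ordering → (ℕ → Set) → ℕ → ℕ → Set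
CovEdge π Keep i j =
  Σ ℕ λ k → IsBond π k × Keep k × ((i ≡ k × j ≡ suc k) ⊎ (j ≡ k × i ≡ suc k))

PolyAdj : Ordering → SecStr → ℕ → ℕ → Set
PolyAdj π S i j = CovEdge π (λ _ → ⊤) i j ⊎ BP S i j

IsConnectedStr : Ordering → SecStr → Set
IsConnectedStr π S = IsConnectedGraph (nBases π) (PolyAdj π S)

record CompIso (N : ℕ) (Adj : ℕ → ℕ → Set) (u w : ℕ) : Set where
  field
    to      : ℕ → ℕ
    from    : ℕ → ℕ
    to-mem  : ∀ m → m < N → Connected-in Adj m u → to m < N × Connected-in Adj (to m) w
    from-mem : ∀ m → m < N → Connected-in Adj m w → from m < N × Connected-in Adj (from m) u
    from-to : ∀ m → m < N → Connected-in Adj m u → from (to m) ≡ m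
    to-from : ∀ m → m < N → Connected-in Adj m w → to (from m) ≡ m
    adj     : ∀ m m' → m < N → m' < N → Connected-in Adj m u → Connected-in Adj m' u →
              Adj m m' ⇔ Adj (to m) (to m')

module _ (π : Ordering) (P : Periodicity π) where
  open Periodicity P

  -- ρ^e : base i of X^n_m ↦ base i of X^(n+e mod v)_m.  Since π = y^v,
  -- this is the shift of the base index by e·|y| (|y| = bases in y) mod N.
  rot : Fin v → ℕ → ℕ
  rot e k = (k + toℕ e * nBases fund) mod nBases π

  -- a subgroup of G^π, given by the set of exponents e with ρ^e ∈ H
  IsSubgroup : Subset v → Set
  IsSubgroup H =
    (Σ (Fin v) λ z → toℕ z ≡ 0 × z ∈ₛ H) ×
    (∀ a b c → a ∈ₛ H → b ∈ₛ H → toℕ c ≡ (toℕ a + toℕ b) mod v → c ∈ₛ H) ×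
    (∀ a → a ∈ₛ H → Σ (Fin v) λ c → c ∈ₛ H × (toℕ a + toℕ c) mod v ≡ 0)

  Invariant : SecStr → Fin v → Set
  Invariant S e = ∀ i j → i < nBases π → j < nBases π → BP S i j ⇔ BP S (rot e i) (rot e j)

  RFoldSymmetric : SecStr → ℕ → Set
  RFoldSymmetric S R =
    Σ (Subset v) λ H → IsSubgroup H × (∀ e → e ∈ₛ H → Invariant S e) × ∣ H ∣ ≡ R ×
      (∀ H' → IsSubgroup H' → (∀ e → e ∈ₛ H' → Invariant S e) → ∣ H' ∣ ≤ R)

  InCut : Subset v → ℕ → ℕ → Set
  InCut H b x = Σ (Fin v) λ e → e ∈ₛ H × x ≡ rot e b

  -- base m lies on the shorter arc ⟦i,j⟧ (ties: the arc from min to max)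
  InShortArc : ℕ → ℕ → ℕ → Set
  InShortArc i j m =
    m < nBases π ×
    ((∣ i - j ∣ + 1 ≤ nBases π ∸ ∣ i - j ∣ + 1 × (i ⊓ j ≤ m × m ≤ i ⊔ j)) ⊎
     (nBases π ∸ ∣ i - j ∣ + 1 < ∣ i - j ∣ + 1 × (m ≤ i ⊓ j ⊎ i ⊔ j ≤ m)))

  Admissible : SecStr → Subset v → ℕ → Set
  Admissible S H b = ∀ x i j → InCut H b x → BP S i j →
    ¬ (InShortArc i j x × InShortArc i j (suc x))

  CutAdj : SecStr → Subset v → ℕ → ℕ → ℕ → Set
  CutAdj S H b i j = CovEdge π (λ k → ¬ InCut H b k) i j ⊎ BP S i j

ExactlyRIsoComponents : ℕ → (ℕ → ℕ → Set) → ℕ → Set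
ExactlyRIsoComponents N Adj R =
  ¬ IsConnectedGraph N Adj ×
  (Σ (Fin R → ℕ) λ r →
     (∀ t → r t < N) ×
     (∀ t t' → Connected-in Adj (r t) (r t') → t ≡ t') ×
     (∀ m → m < N → Σ (Fin R) λ t → Connected-in Adj m (r t)) ×
     (∀ t t' → CompIso N Adj (r t) (r t')))

{-# OPTIONS --safe #-}
module Submission where

-- Index the bases from the base after the cut bond b. Since ρ^e shifts indices by e·|y|, G^π is
-- ℤ/v, and a subgroup of ℤ/v of order R is dℤ/v with R·d = v. So the cut consists of the
-- bonds at the boundaries of R consecutive sectors of D = d·|y| bases, and the symmetry group of
-- S, also of order R, contains the shift by one sector. Admissibility keeps every chord inside
-- its sector, so no edge of the cut graph leaves a sector. Following a path of Poly(S,π) until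
-- it first leaves the sector of its start shows that every base is joined to an end of its
-- sector, and following one from sector 0 to sector 1 shows that the two ends of some sector
-- are joined; the sector shifts, which are automorphisms of the cut graph, carry this to every
-- sector and map components onto each other.

open import Defs
open import Data.Nat using (ℕ; _≤_)
open import Data.Fin.Subset using (Subset; ∣_∣)
open import Relation.Binary.PropositionalEquality using (_≡_)

open import Data.Nat
  using (zero; suc; _+_; _*_; _∸_; _<_; _≡ᵇ_; _⊓_; _⊔_; ∣_-_∣; z≤n; s≤s⁻¹; z<s; s<s; s<s⁻¹;
         NonZero; >-nonZero; >-nonZero⁻¹; _≟_; _<?_; _≤?_)
open import Data.Nat.Properties
open import Data.Nat.DivMod hiding (_mod_)
open import Data.Nat.Divisibility using (_∣_; divides; divides-refl; m%n≡0⇒n∣m; n∣m⇒m%n≡0)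
open import Data.Nat.ListAction using (sum)
open import Data.Nat.ListAction.Properties using (sum-++)
open import Data.Nat.Solver using (module +-*-Solver)
open +-*-Solver using (solve; _:+_; _:*_; _:=_)
open import Data.Bool using (Bool; true; false; if_then_else_)
open import Data.List using ([]; _∷_; _++_; length; map; concat; replicate)
open import Data.List.Properties using (map-++; ++-assoc; ++-identityʳ)
open import Data.Vec using ([]; _∷_; here; there)
open import Data.Fin using (Fin; toℕ; fromℕ<) renaming (zero to fzero; suc to fsuc)
open import Data.Fin.Properties using (toℕ-fromℕ<; toℕ-injective; toℕ<n)
open import Data.Fin.Subset using (_∈_)
open import Data.Product using (Σ; _×_; _,_; proj₁; proj₂)
open import Data.Sum as Sum using (_⊎_; inj₁; inj₂)
open import Function using (_∘_)
open import Function.Bundles using (_⇔_; mk⇔; Equivalence)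
open import Relation.Nullary using (¬_; Dec; yes; no; contradiction)
open import Relation.Binary.PropositionalEquality
  using (refl; sym; trans; cong; cong₂; subst; subst₂; _≢_; module ≡-Reasoning)
open import Relation.Binary.Construct.Closure.ReflexiveTransitive
  using (Star; ε; _◅_; _◅◅_; gmap; reverse)

mod≡% : ∀ m n .{{_ : NonZero n}} → m mod n ≡ m % n
mod≡% m (suc n) = refl

suc[m]%n≡suc[m%n]%n : ∀ m n .{{_ : NonZero n}} → suc m % n ≡ suc (m % n) % n
suc[m]%n≡suc[m%n]%n m n = begin
  suc m % n                             ≡⟨ %-congˡ (cong suc (m≡m%n+[m/n]*n m n)) ⟩
  (suc (m % n) + (m / n) * n) % n       ≡⟨ [m+kn]%n≡m%n (suc (m % n)) (m / n) n ⟩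
  suc (m % n) % n                       ∎
  where open ≡-Reasoning

[m%n+o]%n≡[m+o]%n : ∀ m o n .{{_ : NonZero n}} → (m % n + o) % n ≡ (m + o) % n
[m%n+o]%n≡[m+o]%n m o n = begin
  (m % n + o) % n             ≡⟨ %-distribˡ-+ (m % n) o n ⟩
  (m % n % n + o % n) % n     ≡⟨ %-congˡ (cong (_+ o % n) (m%n%n≡m%n m n)) ⟩
  (m % n + o % n) % n         ≡⟨ %-distribˡ-+ m o n ⟨
  (m + o) % n                 ∎
  where open ≡-Reasoning

[o+m*n]/n≡m : ∀ o m n .{{_ : NonZero n}} → o < n → (o + m * n) / n ≡ m
[o+m*n]/n≡m o m n o<n = begin
  (o + m * n) / n      ≡⟨ +-distrib-/-∣ʳ o (divides m refl) ⟩
  o / n + m * n / n    ≡⟨ cong₂ _+_ (m<n⇒m/n≡0 o<n) (m*n/n≡m m n) ⟩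
  m                    ∎
  where open ≡-Reasoning

suc[m]%n≢0⇒suc[m]/n≡m/n : ∀ m n .{{_ : NonZero n}} → suc m % n ≢ 0 → suc m / n ≡ m / n
suc[m]%n≢0⇒suc[m]/n≡m/n m n ≢0 with suc (m % n) <? n
... | yes lt = begin
  suc m / n                        ≡⟨ /-congˡ (cong suc (m≡m%n+[m/n]*n m n)) ⟩
  (suc (m % n) + (m / n) * n) / n  ≡⟨ [o+m*n]/n≡m (suc (m % n)) (m / n) n lt ⟩
  m / n                            ∎
  where open ≡-Reasoning
... | no ≮ = contradiction (begin
  suc m % n           ≡⟨ suc[m]%n≡suc[m%n]%n m n ⟩
  suc (m % n) % n     ≡⟨ %-congˡ (≤-antisym (m%n<n m n) (≮⇒≥ ≮)) ⟩
  n % n               ≡⟨ n%n≡0 n ⟩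
  0                   ∎) ≢0
  where open ≡-Reasoning

suc[m]%n≢m : ∀ m n .{{_ : NonZero n}} → 1 < n → suc m % n ≢ m
suc[m]%n≢m m n 1<n eq with suc m <? n
... | yes sm<n = <⇒≢ (n<1+n m) (trans (sym eq) (m<n⇒m%n≡m sm<n))
... | no sm≮n = <⇒≢ 1<n (trans (cong suc (sym m≡0)) sm≡n)
  where
  sm≡n : suc m ≡ n
  sm≡n = ≤-antisym (subst (_< n) eq (m%n<n (suc m) n)) (≮⇒≥ sm≮n)
  m≡0 : m ≡ 0
  m≡0 = trans (sym eq) (trans (%-congˡ sm≡n) (n%n≡0 n))

change-point : (f : ℕ → ℕ) → ∀ {a c} → a ≤ c → f a ≢ f c →
               Σ ℕ λ x → a ≤ x × x < c × f x ≢ f (suc x)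
change-point f {a} {zero} z≤n fa≢fc = contradiction refl fa≢fc
change-point f {a} {suc c} a≤c fa≢fc with a ≟ suc c | f c ≟ f (suc c)
... | yes refl | _ = contradiction refl fa≢fc
... | no a≢c | no jump = c , s≤s⁻¹ (≤∧≢⇒< a≤c a≢c) , n<1+n c , jump
... | no a≢c | yes fc≡
  with change-point f (s≤s⁻¹ (≤∧≢⇒< a≤c a≢c)) (λ eq → fa≢fc (trans eq fc≡))
...   | (x , a≤x , x<c , jump) = x , a≤x , m<n⇒m<1+n x<c , jump

nBases-++ : ∀ (xs ys : Ordering) → nBases (xs ++ ys) ≡ nBases xs + nBases ys
nBases-++ xs ys = trans (cong sum (map-++ length xs ys)) (sum-++ (map length xs) (map length ys))

nBases-replicate : ∀ n (y : Ordering) → nBases (concat (replicate n y)) ≡ n * nBases y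
nBases-replicate zero    y = refl
nBases-replicate (suc n) y = trans (nBases-++ y _) (cong (nBases y +_) (nBases-replicate n y))

IsBond⇒suc<nBases : ∀ π k → IsBond π k → suc k < nBases π
IsBond⇒suc<nBases (s ∷ π) k (inj₁ k+1<s) = ≤-trans k+1<s (m≤m+n (length s) (nBases π))
IsBond⇒suc<nBases (s ∷ π) k (inj₂ (s≤k , bond)) = begin-strict
  suc k                       ≡⟨ cong suc (m+[n∸m]≡n s≤k) ⟨
  suc (length s + (k ∸ length s)) ≡⟨ +-suc (length s) (k ∸ length s) ⟨
  length s + suc (k ∸ length s)   <⟨ +-monoʳ-< (length s) (IsBond⇒suc<nBases π _ bond) ⟩
  length s + nBases π         ∎
  where open ≤-Reasoning

IsBond-++ˡ : ∀ xs ys k → IsBond xs k → IsBond (xs ++ ys) k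
IsBond-++ˡ (s ∷ xs) ys k (inj₁ k+1<s) = inj₁ k+1<s
IsBond-++ˡ (s ∷ xs) ys k (inj₂ (s≤k , bond)) = inj₂ (s≤k , IsBond-++ˡ xs ys _ bond)

IsBond-++ʳ : ∀ xs ys k → IsBond ys k → IsBond (xs ++ ys) (nBases xs + k)
IsBond-++ʳ []       ys k bond = bond
IsBond-++ʳ (s ∷ xs) ys k bond = inj₂ (≤-trans (m≤m+n (length s) (nBases xs)) (m≤m+n _ k) ,
  subst (IsBond (xs ++ ys)) (sym (trans (cong (_∸ length s) (+-assoc (length s) (nBases xs) k))
                                        (m+n∸m≡n (length s) (nBases xs + k))))
        (IsBond-++ʳ xs ys k bond))

IsBond-++⁻ : ∀ xs ys k → IsBond (xs ++ ys) k →
             IsBond xs k ⊎ (nBases xs ≤ k × IsBond ys (k ∸ nBases xs))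
IsBond-++⁻ []       ys k bond = inj₂ (z≤n , bond)
IsBond-++⁻ (s ∷ xs) ys k (inj₁ k+1<s) = inj₁ (inj₁ k+1<s)
IsBond-++⁻ (s ∷ xs) ys k (inj₂ (s≤k , bond)) with IsBond-++⁻ xs ys (k ∸ length s) bond
... | inj₁ bond-xs = inj₁ (inj₂ (s≤k , bond-xs))
... | inj₂ (xs≤ , bond-ys) =
  inj₂ ( subst (length s + nBases xs ≤_) (m+[n∸m]≡n s≤k) (+-monoʳ-≤ (length s) xs≤)
       , subst (IsBond ys) (∸-+-assoc k (length s) (nBases xs)) bond-ys)

IsBond-rotate : ∀ xs ys k → IsBond (xs ++ ys) k →
                IsBond (ys ++ xs) ((k + nBases ys) mod nBases (xs ++ ys))
IsBond-rotate xs ys k bond =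
  subst (IsBond (ys ++ xs)) (sym (mod≡% (k + nBases ys) N)) (rotated (IsBond-++⁻ xs ys k bond))
  where
  N = nBases (xs ++ ys)
  instance
    N≢0 : NonZero N
    N≢0 = >-nonZero (≤-<-trans z≤n (IsBond⇒suc<nBases _ k bond))
  N≡ : N ≡ nBases xs + nBases ys
  N≡ = nBases-++ xs ys
  rotated : IsBond xs k ⊎ (nBases xs ≤ k × IsBond ys (k ∸ nBases xs)) →
            IsBond (ys ++ xs) ((k + nBases ys) % N)
  rotated (inj₁ bond-xs) =
    subst (IsBond (ys ++ xs)) (trans (+-comm (nBases ys) k) (sym (m<n⇒m%n≡m k+ys<N)))
          (IsBond-++ʳ ys xs k bond-xs)
    where
    k+ys<N : k + nBases ys < N
    k+ys<N = subst (k + nBases ys <_) (sym N≡)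
               (+-monoˡ-< (nBases ys) (<-trans (n<1+n k) (IsBond⇒suc<nBases xs k bond-xs)))
  rotated (inj₂ (xs≤k , bond-ys)) = subst (IsBond (ys ++ xs)) (sym k+ys%N≡k∸xs)
                                          (IsBond-++ˡ ys xs _ bond-ys)
    where
    open ≡-Reasoning
    k+ys%N≡k∸xs : (k + nBases ys) % N ≡ k ∸ nBases xs
    k+ys%N≡k∸xs = begin
      (k + nBases ys) % N        ≡⟨ m≤n⇒[n∸m]%m≡n%m N≤k+ys ⟨
      (k + nBases ys ∸ N) % N    ≡⟨ %-congˡ k+ys∸N≡k∸xs ⟩
      (k ∸ nBases xs) % N        ≡⟨ m<n⇒m%n≡m k∸xs<N ⟩
      k ∸ nBases xs              ∎
      where
      k+ys∸N≡k∸xs : k + nBases ys ∸ N ≡ k ∸ nBases xs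
      k+ys∸N≡k∸xs = begin
        k + nBases ys ∸ N                         ≡⟨ cong (k + nBases ys ∸_) N≡ ⟩
        k + nBases ys ∸ (nBases xs + nBases ys)   ≡⟨ cong₂ _∸_ (+-comm k _) (+-comm (nBases xs) _) ⟩
        nBases ys + k ∸ (nBases ys + nBases xs)   ≡⟨ [m+n]∸[m+o]≡n∸o (nBases ys) k (nBases xs) ⟩
        k ∸ nBases xs                             ∎
      N≤k+ys : N ≤ k + nBases ys
      N≤k+ys = subst (_≤ k + nBases ys) (sym N≡) (+-monoˡ-≤ (nBases ys) xs≤k)
      k∸xs<N : k ∸ nBases xs < N
      k∸xs<N = <-≤-trans (<-trans (n<1+n _) (IsBond⇒suc<nBases ys _ bond-ys))
                         (subst (nBases ys ≤_) (sym N≡) (m≤n+m (nBases ys) (nBases xs)))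

concat-replicate-++-comm : ∀ n (y : Ordering) →
                           concat (replicate n y) ++ y ≡ y ++ concat (replicate n y)
concat-replicate-++-comm zero    y = sym (++-identityʳ y)
concat-replicate-++-comm (suc n) y =
  trans (++-assoc y (concat (replicate n y)) y) (cong (y ++_) (concat-replicate-++-comm n y))

IsBond-shift-copy : ∀ n (y : Ordering) k → IsBond (concat (replicate n y)) k →
  IsBond (concat (replicate n y)) ((k + nBases y) mod nBases (concat (replicate n y)))
IsBond-shift-copy zero    y k ()
IsBond-shift-copy (suc n) y k bond =
  subst (λ N → IsBond (y ++ W) ((k + nBases y) mod N)) (cong nBases W++y≡y++W)
        (IsBond-rotate W y k (subst (λ π → IsBond π k) (sym W++y≡y++W) bond))
  where
  W = concat (replicate n y)
  W++y≡y++W = concat-replicate-++-comm n y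

-- Subgroups of ℤ/vℤ

-- IsSubgroup π P of Defs, which depends on π and P only through v.
IsSubgroupMod : (v : ℕ) → Subset v → Set
IsSubgroupMod v H =
  (Σ (Fin v) λ z → toℕ z ≡ 0 × z ∈ H) ×
  (∀ a b c → a ∈ H → b ∈ H → toℕ c ≡ (toℕ a + toℕ b) mod v → c ∈ H) ×
  (∀ a → a ∈ H → Σ (Fin v) λ c → c ∈ H × (toℕ a + toℕ c) mod v ≡ 0)

lookupℕ : ∀ {n} → Subset n → ℕ → Bool
lookupℕ []      _       = false
lookupℕ (x ∷ p) zero    = x
lookupℕ (x ∷ p) (suc i) = lookupℕ p i

∈⇒lookupℕ : ∀ {n} (p : Subset n) a → a ∈ p → lookupℕ p (toℕ a) ≡ true
∈⇒lookupℕ (x ∷ p) fzero    here       = refl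
∈⇒lookupℕ (x ∷ p) (fsuc a) (there a∈) = ∈⇒lookupℕ p a a∈

lookupℕ⇒∈ : ∀ {n} (p : Subset n) a → lookupℕ p (toℕ a) ≡ true → a ∈ p
lookupℕ⇒∈ (true ∷ p) fzero    _  = here
lookupℕ⇒∈ (x ∷ p)    (fsuc a) eq = there (lookupℕ⇒∈ p a eq)

count< : ℕ → (ℕ → Bool) → ℕ
count< zero    f = 0
count< (suc n) f = if f 0 then suc (count< n (f ∘ suc)) else count< n (f ∘ suc)

∣p∣≡count<-lookupℕ : ∀ {n} (p : Subset n) → ∣ p ∣ ≡ count< n (lookupℕ p)
∣p∣≡count<-lookupℕ []          = refl
∣p∣≡count<-lookupℕ (true ∷ p)  = cong suc (∣p∣≡count<-lookupℕ p)
∣p∣≡count<-lookupℕ (false ∷ p) = ∣p∣≡count<-lookupℕ p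

count<-cong : ∀ n {f g : ℕ → Bool} → (∀ i → i < n → f i ≡ g i) → count< n f ≡ count< n g
count<-cong zero    f≡g = refl
count<-cong (suc n) f≡g rewrite f≡g 0 z<s = cong (λ c → if _ then suc c else c)
  (count<-cong n (λ i i<n → f≡g (suc i) (s<s i<n)))

count<-+ : ∀ m n (f : ℕ → Bool) → count< (m + n) f ≡ count< m f + count< n (λ i → f (m + i))
count<-+ zero    n f = refl
count<-+ (suc m) n f with f 0
... | true  = cong suc (count<-+ m n (f ∘ suc))
... | false = count<-+ m n (f ∘ suc)

count<-none : ∀ n (f : ℕ → Bool) → (∀ i → i < n → f i ≡ false) → count< n f ≡ 0
count<-none zero    f none = refl
count<-none (suc n) f none rewrite none 0 z<s =
  count<-none n (f ∘ suc) (λ i i<n → none (suc i) (s<s i<n))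

multipleOf : (d : ℕ) .{{_ : NonZero d}} → ℕ → Bool
multipleOf d i = i % d ≡ᵇ 0

count<-multipleOf : ∀ c d .{{_ : NonZero d}} → count< (c * d) (multipleOf d) ≡ c
count<-multipleOf zero    d = refl
count<-multipleOf (suc c) d@(suc d-1) = begin
  count< (d + c * d) (multipleOf d)
    ≡⟨ count<-+ d (c * d) (multipleOf d) ⟩
  count< d (multipleOf d) + count< (c * d) (λ i → multipleOf d (d + i))
    ≡⟨ cong₂ _+_ one (count<-cong (c * d) periodic) ⟩
  1 + count< (c * d) (multipleOf d)
    ≡⟨ cong suc (count<-multipleOf c d) ⟩
  suc c
    ∎
  where
  open ≡-Reasoning
  one : count< d (multipleOf d) ≡ 1
  one = cong suc (count<-none d-1 _ (λ i i<d-1 → cong (_≡ᵇ 0) (m<n⇒m%n≡m (s<s i<d-1))))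
  periodic : ∀ i → i < c * d → multipleOf d (d + i) ≡ multipleOf d i
  periodic i _ = cong (_≡ᵇ 0) (trans (%-congˡ (+-comm d i)) ([m+n]%n≡m%n i d))

least-true : (f : ℕ → Bool) (n : ℕ) →
  (Σ ℕ λ k → k < n × f k ≡ true × (∀ j → j < k → f j ≡ false)) ⊎
  (∀ j → j < n → f j ≡ false)
least-true f zero = inj₂ (λ j ())
least-true f (suc n) with least-true f n
... | inj₁ (k , k<n , fk , below) = inj₁ (k , m<n⇒m<1+n k<n , fk , below)
... | inj₂ none with f n in fn
... | true  = inj₁ (n , n<1+n n , fn , none)
... | false = inj₂ none′
  where
  none′ : ∀ j → j < suc n → f j ≡ false
  none′ j j<1+n with m≤n⇒m<n∨m≡n (s≤s⁻¹ j<1+n)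
  ... | inj₁ j<n  = none j j<n
  ... | inj₂ refl = fn

record Generator (v : ℕ) (H : Subset v) : Set where
  field
    d          : ℕ
    {{d≢0}}    : NonZero d
    ∣H∣*d≡v    : ∣ H ∣ * d ≡ v
    ∈⇔d∣       : ∀ a → a ∈ H ⇔ d ∣ toℕ a

module Subgroup {v : ℕ} .{{_ : NonZero v}} {H : Subset v} (H≤ : IsSubgroupMod v H) where

  Member : ℕ → Set
  Member n = Σ (Fin v) λ a → toℕ a ≡ n × a ∈ H

  Member⇒<v : ∀ {n} → Member n → n < v
  Member⇒<v (a , refl , _) = toℕ<n a

  lookupℕ⇒Member : ∀ n → n < v → lookupℕ H n ≡ true → Member n
  lookupℕ⇒Member n n<v eq = fromℕ< n<v , toℕ-fromℕ< n<v ,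
    lookupℕ⇒∈ H (fromℕ< n<v) (subst (λ i → lookupℕ H i ≡ true) (sym (toℕ-fromℕ< n<v)) eq)

  Member⇒lookupℕ : ∀ {n} → Member n → lookupℕ H n ≡ true
  Member⇒lookupℕ (a , refl , a∈) = ∈⇒lookupℕ H a a∈

  Member-0 : Member 0
  Member-0 = proj₁ H≤

  Member-+ : ∀ {m n} → Member m → Member n → Member ((m + n) % v)
  Member-+ {m} {n} (a , refl , a∈) (b , refl , b∈) =
    c , toℕ-fromℕ< m+n%v<v ,
    proj₁ (proj₂ H≤) a b c a∈ b∈ (trans (toℕ-fromℕ< m+n%v<v) (sym (mod≡% (m + n) v)))
    where
    m+n%v<v = m%n<n (m + n) v
    c = fromℕ< m+n%v<v

  Member-* : ∀ k {n} → Member n → Member ((k * n) % v)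
  Member-* zero    n∈ = subst Member (sym (m<n⇒m%n≡m (>-nonZero⁻¹ v))) Member-0
  Member-* (suc k) {n} n∈ = subst Member (begin
    (n + (k * n) % v) % v   ≡⟨ %-congˡ (+-comm n _) ⟩
    ((k * n) % v + n) % v   ≡⟨ [m%n+o]%n≡[m+o]%n (k * n) n v ⟩
    (k * n + n) % v         ≡⟨ %-congˡ (+-comm (k * n) n) ⟩
    (n + k * n) % v         ∎) (Member-+ n∈ (Member-* k n∈))
    where open ≡-Reasoning

  Member-neg : ∀ {n} → Member n → Member ((v ∸ n) % v)
  Member-neg {n} n∈@(a , refl , a∈) with proj₂ (proj₂ H≤) a a∈
  ... | (c , c∈ , a+c≡0) = subst Member (begin
    toℕ c                              ≡⟨ m<n⇒m%n≡m (toℕ<n c) ⟨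
    toℕ c % v                          ≡⟨ [m+n]%n≡m%n (toℕ c) v ⟨
    (toℕ c + v) % v                    ≡⟨ %-congˡ (cong (toℕ c +_) (m+[n∸m]≡n (<⇒≤ (toℕ<n a)))) ⟨
    (toℕ c + (n + (v ∸ n))) % v        ≡⟨ %-congˡ (+-assoc (toℕ c) n (v ∸ n)) ⟨
    (toℕ c + n + (v ∸ n)) % v          ≡⟨ [m%n+o]%n≡[m+o]%n (toℕ c + n) (v ∸ n) v ⟨
    ((toℕ c + n) % v + (v ∸ n)) % v    ≡⟨ %-congˡ (cong (_+ (v ∸ n)) c+n%v≡0) ⟩
    (v ∸ n) % v                        ∎) (c , refl , c∈)
    where
    open ≡-Reasoning
    c+n%v≡0 : (toℕ c + n) % v ≡ 0
    c+n%v≡0 = trans (%-congˡ (+-comm (toℕ c) n)) (trans (sym (mod≡% (n + toℕ c) v)) a+c≡0)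

  Member-∸ : ∀ {m n} → Member m → Member n → n ≤ m → Member (m ∸ n)
  Member-∸ {m} {n} m∈ n∈ n≤m = subst Member (begin
    (m + (v ∸ n) % v) % v   ≡⟨ %-congˡ (+-comm m _) ⟩
    ((v ∸ n) % v + m) % v   ≡⟨ [m%n+o]%n≡[m+o]%n (v ∸ n) m v ⟩
    (v ∸ n + m) % v         ≡⟨ %-congˡ (+-comm (v ∸ n) m) ⟩
    (m + (v ∸ n)) % v       ≡⟨ %-congˡ (+-∸-assoc m (<⇒≤ (Member⇒<v n∈))) ⟨
    (m + v ∸ n) % v         ≡⟨ %-congˡ (+-∸-comm v n≤m) ⟩
    (m ∸ n + v) % v         ≡⟨ [m+n]%n≡m%n (m ∸ n) v ⟩
    (m ∸ n) % v             ≡⟨ m<n⇒m%n≡m (≤-<-trans (m∸n≤m m n) (Member⇒<v m∈)) ⟩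
    m ∸ n                   ∎) (Member-+ m∈ (Member-neg n∈))
    where open ≡-Reasoning

  module LeastPositive (d : ℕ) .{{_ : NonZero d}} (d∈ : Member d)
                       (d-least : ∀ e → 0 < e → e < d → ¬ Member e) where

    Member⇒d∣ : ∀ {e} → Member e → d ∣ e
    Member⇒d∣ {e} e∈ with e % d in e%d≡
    ... | zero  = m%n≡0⇒n∣m e d e%d≡
    ... | suc _ = contradiction e%d∈ (d-least (e % d) (subst (0 <_) (sym e%d≡) z<s) (m%n<n e d))
      where
      q*d∈ : Member ((e / d) * d)
      q*d∈ = subst Member (m<n⇒m%n≡m (≤-<-trans (m/n*n≤m e d) (Member⇒<v e∈)))
                     (Member-* (e / d) d∈)
      e%d∈ : Member (e % d)
      e%d∈ = subst Member (sym (m%n≡m∸m/n*n e d)) (Member-∸ e∈ q*d∈ (m/n*n≤m e d))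

    d∣⇒Member : ∀ {e} → d ∣ e → e < v → Member e
    d∣⇒Member (divides-refl q) e<v = subst Member (m<n⇒m%n≡m e<v) (Member-* q d∈)

    d∣v : d ∣ v
    d∣v with v % d in v%d≡
    ... | zero  = m%n≡0⇒n∣m v d v%d≡
    ... | suc _ = contradiction v%d∈ (d-least (v % d) 0<v%d (m%n<n v d))
      where
      0<v%d : 0 < v % d
      0<v%d = subst (0 <_) (sym v%d≡) z<s
      q*d<v : (v / d) * d < v
      q*d<v = subst ((v / d) * d <_) (sym (m≡m%n+[m/n]*n v d)) (m<n+m _ 0<v%d)
      q*d∈ : Member ((v / d) * d)
      q*d∈ = subst Member (m<n⇒m%n≡m q*d<v) (Member-* (v / d) d∈)
      v%d∈ : Member (v % d)
      v%d∈ = subst Member (trans (%-congˡ (sym (m%n≡m∸m/n*n v d)))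
                                 (m<n⇒m%n≡m (<-trans (m%n<n v d) (Member⇒<v d∈))))
                   (Member-neg q*d∈)

    lookupℕ≡multipleOf : ∀ i → i < v → lookupℕ H i ≡ multipleOf d i
    lookupℕ≡multipleOf i i<v with lookupℕ H i in i∈ | i % d in i%d≡
    ... | true  | zero  = refl
    ... | false | suc _ = refl
    ... | true  | suc _ = contradiction
      (trans (sym i%d≡) (n∣m⇒m%n≡0 i d (Member⇒d∣ (lookupℕ⇒Member i i<v i∈)))) λ ()
    ... | false | zero  = contradiction
      (trans (sym i∈) (Member⇒lookupℕ (d∣⇒Member (m%n≡0⇒n∣m i d i%d≡) i<v))) λ ()

    ∣H∣*d≡v : ∣ H ∣ * d ≡ v
    ∣H∣*d≡v with d∣v
    ... | divides c v≡c*d = begin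
      ∣ H ∣ * d                              ≡⟨ cong (_* d) (∣p∣≡count<-lookupℕ H) ⟩
      count< v (lookupℕ H) * d               ≡⟨ cong (_* d) (count<-cong v lookupℕ≡multipleOf) ⟩
      count< v (multipleOf d) * d            ≡⟨ cong (λ n → count< n (multipleOf d) * d) v≡c*d ⟩
      count< (c * d) (multipleOf d) * d      ≡⟨ cong (_* d) (count<-multipleOf c d) ⟩
      c * d                                  ≡⟨ v≡c*d ⟨
      v                                      ∎
      where open ≡-Reasoning

subgroup-generator : ∀ {v} {H : Subset v} → IsSubgroupMod v H → 2 ≤ ∣ H ∣ → Generator v H
subgroup-generator {zero}    {[]} _ ()
subgroup-generator {suc v-1} {H} H≤ 2≤∣H∣ with least-true (lookupℕ H ∘ suc) v-1
... | inj₂ none = contradiction 2≤∣H∣ (<⇒≱ (s<s ∣H∣≤1))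
  where
  ∣H∣≤1 : ∣ H ∣ ≤ 1
  ∣H∣≤1 rewrite ∣p∣≡count<-lookupℕ H | count<-none v-1 (lookupℕ H ∘ suc) none
    with lookupℕ H 0
  ... | true  = ≤-refl
  ... | false = z≤n
... | inj₁ (k , k<v-1 , k+1∈H , below) = record
  { d       = suc k
  ; ∣H∣*d≡v = ∣H∣*d≡v
  ; ∈⇔d∣    = λ a → mk⇔ (λ a∈ → Member⇒d∣ (a , refl , a∈))
                        (λ d∣a → let (a′ , a′≡a , a′∈) = d∣⇒Member d∣a (toℕ<n a)
                                 in subst (_∈ H) (toℕ-injective a′≡a) a′∈)
  }
  where
  open Subgroup H≤
  d-least : ∀ e → 0 < e → e < suc k → ¬ Member e
  d-least (suc e) _ e<k e∈ =
    contradiction (trans (sym (Member⇒lookupℕ e∈)) (below e (s<s⁻¹ e<k))) λ ()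
  open LeastPositive (suc k) (lookupℕ⇒Member (suc k) (s<s k<v-1) k+1∈H) d-least

-- Sectors

-- pos m is the position of base m counted from base suc b; sector t consists of the
-- positions t·D, …, t·D + D ∸ 1, and Boundary x says that base suc x begins a sector.
module Sectors (N R D : ℕ) .{{_ : NonZero N}} .{{_ : NonZero R}} .{{_ : NonZero D}}
               (N≡R*D : N ≡ R * D) (b : ℕ) (b<N : b < N) where

  private
    instance
      R*D≢0 : NonZero (R * D)
      R*D≢0 = m*n≢0 R D

    D∣N : D ∣ N
    D∣N = divides R N≡R*D

    m%N%D≡m%D : ∀ m → m % N % D ≡ m % D
    m%N%D≡m%D m = m∣n⇒o%n%m≡o%m D N m D∣N

    m%N≡m%[R*D] : ∀ m → m % N ≡ m % (R * D)
    m%N≡m%[R*D] m = %-congʳ N≡R*D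

    0<D : 0 < D
    0<D = >-nonZero⁻¹ D

    D∸1<D : D ∸ 1 < D
    D∸1<D = ∸-monoʳ-< z<s 0<D

  pos : ℕ → ℕ
  pos m = (m + (N ∸ suc b)) % N

  unpos : ℕ → ℕ
  unpos p = (p + suc b) % N

  pos<N : ∀ m → pos m < N
  pos<N m = m%n<n _ N

  unpos-pos : ∀ m → unpos (pos m) ≡ m % N
  unpos-pos m = begin
    ((m + (N ∸ suc b)) % N + suc b) % N   ≡⟨ [m%n+o]%n≡[m+o]%n (m + (N ∸ suc b)) (suc b) N ⟩
    (m + (N ∸ suc b) + suc b) % N         ≡⟨ %-congˡ (+-assoc m (N ∸ suc b) (suc b)) ⟩
    (m + ((N ∸ suc b) + suc b)) % N       ≡⟨ %-congˡ (cong (m +_) (m∸n+n≡m b<N)) ⟩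
    (m + N) % N                           ≡⟨ [m+n]%n≡m%n m N ⟩
    m % N                                 ∎
    where open ≡-Reasoning

  pos-unpos : ∀ p → pos (unpos p) ≡ p % N
  pos-unpos p = begin
    ((p + suc b) % N + (N ∸ suc b)) % N   ≡⟨ [m%n+o]%n≡[m+o]%n (p + suc b) (N ∸ suc b) N ⟩
    (p + suc b + (N ∸ suc b)) % N         ≡⟨ %-congˡ (+-assoc p (suc b) (N ∸ suc b)) ⟩
    (p + (suc b + (N ∸ suc b))) % N       ≡⟨ %-congˡ (cong (p +_) (m+[n∸m]≡n b<N)) ⟩
    (p + N) % N                           ≡⟨ [m+n]%n≡m%n p N ⟩
    p % N                                 ∎
    where open ≡-Reasoning

  pos-injective : ∀ {m m′} → m < N → m′ < N → pos m ≡ pos m′ → m ≡ m′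
  pos-injective {m} {m′} m<N m′<N eq = begin
    m               ≡⟨ m<n⇒m%n≡m m<N ⟨
    m % N           ≡⟨ unpos-pos m ⟨
    unpos (pos m)   ≡⟨ cong unpos eq ⟩
    unpos (pos m′)  ≡⟨ unpos-pos m′ ⟩
    m′ % N          ≡⟨ m<n⇒m%n≡m m′<N ⟩
    m′              ∎
    where open ≡-Reasoning

  pos-+ : ∀ m c → pos ((m + c) % N) ≡ (pos m + c) % N
  pos-+ m c = begin
    ((m + c) % N + (N ∸ suc b)) % N   ≡⟨ [m%n+o]%n≡[m+o]%n (m + c) (N ∸ suc b) N ⟩
    (m + c + (N ∸ suc b)) % N         ≡⟨ %-congˡ (+-assoc m c _) ⟩
    (m + (c + (N ∸ suc b))) % N       ≡⟨ %-congˡ (cong (m +_) (+-comm c _)) ⟩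
    (m + ((N ∸ suc b) + c)) % N       ≡⟨ %-congˡ (+-assoc m _ c) ⟨
    (m + (N ∸ suc b) + c) % N         ≡⟨ [m%n+o]%n≡[m+o]%n (m + (N ∸ suc b)) c N ⟨
    (pos m + c) % N                   ∎
    where open ≡-Reasoning

  pos-suc : ∀ m → pos (suc m) ≡ suc (pos m) % N
  pos-suc m = suc[m]%n≡suc[m%n]%n (m + (N ∸ suc b)) N

  pos-suc-b : pos (suc b) ≡ 0
  pos-suc-b = trans (%-congˡ (m+[n∸m]≡n b<N)) (n%n≡0 N)

  sector : ℕ → ℕ
  sector m = pos m / D

  sector<R : ∀ m → sector m < R
  sector<R m = m<n*o⇒m/o<n (subst (pos m <_) N≡R*D (pos<N m))

  sector-from-pos : ∀ {x o t} → o < D → pos x ≡ o + t * D → sector x ≡ t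
  sector-from-pos {o = o} {t} o<D eq = trans (/-congˡ eq) ([o+m*n]/n≡m o t D o<D)

  Boundary : ℕ → Set
  Boundary x = pos (suc x) % D ≡ 0

  boundary? : ∀ x → Dec (Boundary x)
  boundary? x = pos (suc x) % D ≟ 0

  pos-suc-%D : ∀ x → pos (suc x) % D ≡ suc (pos x) % D
  pos-suc-%D x = trans (%-congˡ (pos-suc x)) (m%N%D≡m%D (suc (pos x)))

  ¬Boundary⇒pos-suc : ∀ {x} → ¬ Boundary x → pos (suc x) ≡ suc (pos x)
  ¬Boundary⇒pos-suc {x} ¬bd with suc (pos x) <? N
  ... | yes lt = trans (pos-suc x) (m<n⇒m%n≡m lt)
  ... | no ≮ = contradiction (begin
    pos (suc x) % D      ≡⟨ pos-suc-%D x ⟩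
    suc (pos x) % D      ≡⟨ %-congˡ (≤-antisym (pos<N x) (≮⇒≥ ≮)) ⟩
    N % D                ≡⟨ %-congˡ N≡R*D ⟩
    (R * D) % D          ≡⟨ m*n%n≡0 R D ⟩
    0                    ∎) ¬bd
    where open ≡-Reasoning

  sector-suc : ∀ {x} → ¬ Boundary x → sector (suc x) ≡ sector x
  sector-suc {x} ¬bd = trans (/-congˡ (¬Boundary⇒pos-suc ¬bd))
    (suc[m]%n≢0⇒suc[m]/n≡m/n (pos x) D (λ eq → ¬bd (trans (pos-suc-%D x) eq)))

  Boundary⇒pos : ∀ {x} → Boundary x → pos x ≡ (D ∸ 1) + sector x * D
  Boundary⇒pos {x} bd = trans (m≡m%n+[m/n]*n (pos x) D)
    (cong (_+ sector x * D) (%-pred-≡0 (trans (sym (pos-suc-%D x)) bd)))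

  Boundary⇒pos-suc : ∀ {x} → Boundary x → pos (suc x) ≡ (suc (sector x) % R) * D
  Boundary⇒pos-suc {x} bd = begin
    pos (suc x)                          ≡⟨ pos-suc x ⟩
    suc (pos x) % N                      ≡⟨ %-congˡ (cong suc (Boundary⇒pos bd)) ⟩
    suc ((D ∸ 1) + sector x * D) % N     ≡⟨ %-congˡ (cong (_+ sector x * D) (suc-pred D)) ⟩
    (suc (sector x) * D) % N             ≡⟨ m%N≡m%[R*D] _ ⟩
    (suc (sector x) * D) % (R * D)       ≡⟨ m%n*o≡m*o%[n*o] (suc (sector x)) R D ⟨
    (suc (sector x) % R) * D             ∎
    where open ≡-Reasoning

  Boundary⇒sector-suc : ∀ {x} → Boundary x → sector (suc x) ≡ suc (sector x) % R
  Boundary⇒sector-suc {x} bd = trans (/-congˡ (Boundary⇒pos-suc bd)) (m*n/n≡m _ D)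

  first : ℕ → ℕ
  first t = unpos (t * D)

  last : ℕ → ℕ
  last t = unpos ((D ∸ 1) + t * D)

  first<N : ∀ t → first t < N
  first<N t = m%n<n _ N

  t*D<N : ∀ {t} → t < R → t * D < N
  t*D<N t<R = subst (_ <_) (sym N≡R*D) (*-monoˡ-< D t<R)

  D∸1+t*D<N : ∀ {t} → t < R → (D ∸ 1) + t * D < N
  D∸1+t*D<N {t} t<R = subst (_ <_) (sym N≡R*D) (begin-strict
    (D ∸ 1) + t * D   <⟨ +-monoˡ-< (t * D) D∸1<D ⟩
    D + t * D         ≤⟨ *-monoˡ-≤ D t<R ⟩
    R * D             ∎)
    where open ≤-Reasoning

  pos-first : ∀ {t} → t < R → pos (first t) ≡ t * D
  pos-first t<R = trans (pos-unpos _) (m<n⇒m%n≡m (t*D<N t<R))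

  pos-last : ∀ {t} → t < R → pos (last t) ≡ (D ∸ 1) + t * D
  pos-last t<R = trans (pos-unpos _) (m<n⇒m%n≡m (D∸1+t*D<N t<R))

  sector-first : ∀ {t} → t < R → sector (first t) ≡ t
  sector-first t<R = sector-from-pos 0<D (pos-first t<R)

  Boundary⇒≡last : ∀ {x} → x < N → Boundary x → x ≡ last (sector x)
  Boundary⇒≡last {x} x<N bd = begin
    x                                 ≡⟨ m<n⇒m%n≡m x<N ⟨
    x % N                             ≡⟨ unpos-pos x ⟨
    unpos (pos x)                     ≡⟨ cong unpos (Boundary⇒pos bd) ⟩
    last (sector x)                   ∎
    where open ≡-Reasoning

  Boundary⇒suc≡first : ∀ {x} → suc x < N → Boundary x → suc x ≡ first (sector (suc x))
  Boundary⇒suc≡first {x} sx<N bd = begin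
    suc x                             ≡⟨ m<n⇒m%n≡m sx<N ⟨
    suc x % N                         ≡⟨ unpos-pos (suc x) ⟨
    unpos (pos (suc x))               ≡⟨ cong unpos (Boundary⇒pos-suc bd) ⟩
    unpos ((suc (sector x) % R) * D)  ≡⟨ cong (λ t → unpos (t * D)) (Boundary⇒sector-suc bd) ⟨
    first (sector (suc x))            ∎
    where open ≡-Reasoning

  shift : ℕ → ℕ → ℕ
  shift n m = (m + n * D) % N

  shift<N : ∀ n m → shift n m < N
  shift<N n m = m%n<n _ N

  shift-shift : ∀ a c m → shift a (shift c m) ≡ shift (c + a) m
  shift-shift a c m = trans ([m%n+o]%n≡[m+o]%n (m + c * D) (a * D) N)
    (%-congˡ (trans (+-assoc m (c * D) (a * D)) (cong (m +_) (sym (*-distribʳ-+ D c a)))))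

  shift-*R : ∀ k {m} → m < N → shift (k * R) m ≡ m
  shift-*R k {m} m<N = begin
    (m + k * R * D) % N     ≡⟨ %-congˡ (cong (m +_) (trans (*-assoc k R D)
                                                              (cong (k *_) (sym N≡R*D)))) ⟩
    (m + k * N) % N         ≡⟨ [m+kn]%n≡m%n m k N ⟩
    m % N                   ≡⟨ m<n⇒m%n≡m m<N ⟩
    m                       ∎
    where open ≡-Reasoning

  shift-suc : ∀ n {k} → suc (shift n k) < N → shift n (suc k) ≡ suc (shift n k)
  shift-suc n {k} lt = trans (suc[m]%n≡suc[m%n]%n (k + n * D) N) (m<n⇒m%n≡m lt)

  pos-shift : ∀ n m → pos (shift n m) ≡ (pos m + n * D) % N
  pos-shift n m = pos-+ m (n * D)

  shift-first : ∀ n {t} → t < R → shift n (first t) ≡ first ((t + n) % R)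
  shift-first n {t} t<R = pos-injective (shift<N n _) (first<N ((t + n) % R)) (begin
    pos (shift n (first t))      ≡⟨ pos-shift n (first t) ⟩
    (pos (first t) + n * D) % N  ≡⟨ %-congˡ (cong (_+ n * D) (pos-first t<R)) ⟩
    (t * D + n * D) % N          ≡⟨ %-congˡ (*-distribʳ-+ D t n) ⟨
    ((t + n) * D) % N            ≡⟨ m%N≡m%[R*D] _ ⟩
    ((t + n) * D) % (R * D)      ≡⟨ m%n*o≡m*o%[n*o] (t + n) R D ⟨
    ((t + n) % R) * D            ≡⟨ pos-first (m%n<n (t + n) R) ⟨
    pos (first ((t + n) % R))    ∎)
    where open ≡-Reasoning

  shift-last : ∀ n {t} → t < R → shift n (last t) ≡ last ((t + n) % R)
  shift-last n {t} t<R = pos-injective (shift<N n _) (m%n<n _ N) (begin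
    pos (shift n (last t))                    ≡⟨ pos-shift n (last t) ⟩
    (pos (last t) + n * D) % N                ≡⟨ %-congˡ (cong (_+ n * D) (pos-last t<R)) ⟩
    ((D ∸ 1) + t * D + n * D) % N             ≡⟨ %-congˡ (rearrange (D ∸ 1) t n D) ⟩
    ((t + n) * D + (D ∸ 1)) % N               ≡⟨ m%N≡m%[R*D] _ ⟩
    ((t + n) * D + (D ∸ 1)) % (R * D)         ≡⟨ [m*n+o]%[p*n]≡[m*n]%[p*n]+o (t + n) R D∸1<D ⟩
    ((t + n) * D) % (R * D) + (D ∸ 1)         ≡⟨ cong (_+ (D ∸ 1)) (m%n*o≡m*o%[n*o] (t + n) R D) ⟨
    ((t + n) % R) * D + (D ∸ 1)               ≡⟨ +-comm _ (D ∸ 1) ⟩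
    (D ∸ 1) + ((t + n) % R) * D               ≡⟨ pos-last (m%n<n (t + n) R) ⟨
    pos (last ((t + n) % R))                  ∎)
    where
    open ≡-Reasoning
    rearrange : ∀ o t n D → o + t * D + n * D ≡ (t + n) * D + o
    rearrange = solve 4 (λ o t n D → o :+ t :* D :+ n :* D := (t :+ n) :* D :+ o) refl

  Boundary-shift⁻ : ∀ n {x} → suc (shift n x) < N → Boundary (shift n x) → Boundary x
  Boundary-shift⁻ n {x} lt bd = begin
    pos (suc x) % D                      ≡⟨ [m+kn]%n≡m%n (pos (suc x)) n D ⟨
    (pos (suc x) + n * D) % D            ≡⟨ m%N%D≡m%D _ ⟨
    (pos (suc x) + n * D) % N % D        ≡⟨ %-congˡ (pos-shift n (suc x)) ⟨
    pos (shift n (suc x)) % D            ≡⟨ %-congˡ (cong pos (shift-suc n lt)) ⟩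
    pos (suc (shift n x)) % D            ≡⟨ bd ⟩
    0                                    ∎
    where open ≡-Reasoning

  Boundary-shift-b : ∀ j → suc (shift j b) < N → Boundary (shift j b)
  Boundary-shift-b j lt = begin
    pos (suc (shift j b)) % D            ≡⟨ %-congˡ (cong pos (shift-suc j lt)) ⟨
    pos (shift j (suc b)) % D            ≡⟨ %-congˡ (pos-shift j (suc b)) ⟩
    (pos (suc b) + j * D) % N % D        ≡⟨ m%N%D≡m%D _ ⟩
    (pos (suc b) + j * D) % D            ≡⟨ %-congˡ (cong (_+ j * D) pos-suc-b) ⟩
    (j * D) % D                          ≡⟨ m*n%n≡0 j D ⟩
    0                                    ∎
    where open ≡-Reasoning

  Boundary⇒≡shift-b : ∀ {x} → Boundary x → suc x % N ≡ suc (shift (sector (suc x)) b) % N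
  Boundary⇒≡shift-b {x} bd = begin
    suc x % N                    ≡⟨ unpos-pos (suc x) ⟨
    unpos (pos (suc x))          ≡⟨ cong unpos pos-suc-x≡j*D ⟩
    (j * D + suc b) % N          ≡⟨ %-congˡ (+-comm (j * D) (suc b)) ⟩
    suc (b + j * D) % N          ≡⟨ suc[m]%n≡suc[m%n]%n (b + j * D) N ⟩
    suc (shift j b) % N          ∎
    where
    open ≡-Reasoning
    j = sector (suc x)
    pos-suc-x≡j*D : pos (suc x) ≡ j * D
    pos-suc-x≡j*D = trans (m≡m%n+[m/n]*n (pos (suc x)) D) (cong (_+ j * D) bd)

-- Graphs whose components are the sectors

-- Adj stands for the cut graph, Poly for the polymer graph and shift n for the rotation by n sectors.
module SectorGraph
  (N R : ℕ) .{{_ : NonZero R}} (1<R : 1 < R)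
  (Adj Poly : ℕ → ℕ → Set)
  (sector : ℕ → ℕ) (sector<R : ∀ m → sector m < R)
  (first last : ℕ → ℕ) (first<N : ∀ t → first t < N)
  (sector-first : ∀ {t} → t < R → sector (first t) ≡ t)
  (Adj-sym : ∀ {i j} → Adj i j → Adj j i)
  (Adj-sector : ∀ {i j} → Adj i j → sector i ≡ sector j)
  (Poly-connected : IsConnectedGraph N Poly)
  (Poly-sector : ∀ {i j} → Poly i j → sector i ≡ sector j → Adj i j)
  (Poly-across : ∀ {i j} → Poly i j → sector i ≢ sector j →
     (i ≡ last (sector i) × j ≡ first (sector j) × sector j ≡ suc (sector i) % R) ⊎
     (i ≡ first (sector i) × j ≡ last (sector j) × sector i ≡ suc (sector j) % R))
  (shift : ℕ → ℕ → ℕ) (shift<N : ∀ n m → shift n m < N)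
  (shift-Adj : ∀ n {i j} → Adj i j → Adj (shift n i) (shift n j))
  (shift-shift : ∀ a c m → shift a (shift c m) ≡ shift (c + a) m)
  (shift-*R : ∀ k {m} → m < N → shift (k * R) m ≡ m)
  (shift-first : ∀ n {t} → t < R → shift n (first t) ≡ first ((t + n) % R))
  (shift-last : ∀ n {t} → t < R → shift n (last t) ≡ last ((t + n) % R))
  where

  private
    0<R : 0 < R
    0<R = <-trans z<s 1<R

    R∸1<R : R ∸ 1 < R
    R∸1<R = ∸-monoʳ-< z<s 0<R

    suc[R∸1]%R≡0 : suc (R ∸ 1) % R ≡ 0
    suc[R∸1]%R≡0 = trans (%-congˡ (suc-pred R)) (n%n≡0 R)

    suc[t]%R≡0⇒t≡R∸1 : ∀ {t} → t < R → suc t % R ≡ 0 → t ≡ R ∸ 1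
    suc[t]%R≡0⇒t≡R∸1 t<R eq = trans (sym (m<n⇒m%n≡m t<R)) (%-pred-≡0 eq)

  Adj*-sector : ∀ {i j} → Star Adj i j → sector i ≡ sector j
  Adj*-sector ε        = refl
  Adj*-sector (e ◅ es) = trans (Adj-sector e) (Adj*-sector es)

  Adj*-sym : ∀ {i j} → Star Adj i j → Star Adj j i
  Adj*-sym = reverse Adj-sym

  shift-Adj* : ∀ n {i j} → Star Adj i j → Star Adj (shift n i) (shift n j)
  shift-Adj* n = gmap (shift n) (shift-Adj n)

  ≡⇒Adj* : ∀ {i j} → i ≡ j → Star Adj i j
  ≡⇒Adj* refl = ε

  joined-to-end-along : ∀ {c w} → Star Poly c w → sector w ≢ sector c →
                        Star Adj c (first (sector c)) ⊎ Star Adj c (last (sector c))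
  joined-to-end-along ε w≢c = contradiction refl w≢c
  joined-to-end-along {c} (_◅_ {j = c₁} e rest) w≢c with sector c₁ ≟ sector c
  ... | yes same with joined-to-end-along rest (λ eq → w≢c (trans eq same))
  ...   | inj₁ p = inj₁ (Poly-sector e (sym same) ◅ subst (Star Adj c₁ ∘ first) same p)
  ...   | inj₂ p = inj₂ (Poly-sector e (sym same) ◅ subst (Star Adj c₁ ∘ last) same p)
  joined-to-end-along (e ◅ rest) w≢c | no differ with Poly-across e (differ ∘ sym)
  ... | inj₁ (c≡last , _)  = inj₂ (≡⇒Adj* c≡last)
  ... | inj₂ (c≡first , _) = inj₁ (≡⇒Adj* c≡first)

  joined-to-end : ∀ m → m < N → Star Adj m (first (sector m)) ⊎ Star Adj m (last (sector m))
  joined-to-end m m<N =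
    joined-to-end-along (Poly-connected m (first next) m<N (first<N next)) next≢m
    where
    next = suc (sector m) % R
    next≢m : sector (first next) ≢ sector m
    next≢m eq = suc[m]%n≢m (sector m) R 1<R (trans (sym (sector-first (m%n<n _ R))) eq)

  SomeSectorSpanned : Set
  SomeSectorSpanned = Σ ℕ λ t → t < R × Star Adj (first t) (last t)

  JoinedWithin : ℕ → ℕ → ℕ → Set
  JoinedWithin t x c = sector c ≡ t × Star Adj c x

  JoinedWithin-step : ∀ {t x c c₁} → Poly c c₁ → sector c₁ ≡ sector c →
                      JoinedWithin t x c → JoinedWithin t x c₁
  JoinedWithin-step e same (c∈t , p) = trans same c∈t , Adj-sym (Poly-sector e (sym same)) ◅ p

  -- Along a Poly walk from first 0, until a spanned sector shows up, the current base stays joined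
  -- to first 0 or to last (R ∸ 1): leaving sector 0 through first 0 lands on last (R ∸ 1), and
  -- leaving sector R ∸ 1 through last (R ∸ 1) lands on first 0.
  WalkInvariant : ℕ → Set
  WalkInvariant c =
    SomeSectorSpanned ⊎ (JoinedWithin 0 (first 0) c ⊎ JoinedWithin (R ∸ 1) (last (R ∸ 1)) c)

  WalkInvariant-step : ∀ {c c₁} → Poly c c₁ → WalkInvariant c → WalkInvariant c₁
  WalkInvariant-step e (inj₁ spanned) = inj₁ spanned
  WalkInvariant-step {c} {c₁} e (inj₂ joined) with sector c₁ ≟ sector c
  ... | yes same = inj₂ (Sum.map (JoinedWithin-step e same) (JoinedWithin-step e same) joined)
  ... | no differ with Poly-across e (differ ∘ sym) | joined
  ...   | inj₁ (c≡last , _ , _) | inj₁ (c∈0 , p) =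
          inj₁ (0 , 0<R , Adj*-sym p ◅◅ ≡⇒Adj* (trans c≡last (cong last c∈0)))
  ...   | inj₁ (_ , c₁≡first , c₁-next) | inj₂ (c∈R-1 , _) =
          inj₂ (inj₁ (c₁∈0 , ≡⇒Adj* (trans c₁≡first (cong first c₁∈0))))
    where
    c₁∈0 : sector c₁ ≡ 0
    c₁∈0 = trans c₁-next (trans (cong (λ t → suc t % R) c∈R-1) suc[R∸1]%R≡0)
  ...   | inj₂ (_ , c₁≡last , c-next) | inj₁ (c∈0 , _) =
          inj₂ (inj₂ (c₁∈R-1 , ≡⇒Adj* (trans c₁≡last (cong last c₁∈R-1))))
    where
    c₁∈R-1 : sector c₁ ≡ R ∸ 1
    c₁∈R-1 = suc[t]%R≡0⇒t≡R∸1 (sector<R c₁) (trans (sym c-next) c∈0)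
  ...   | inj₂ (c≡first , _ , _) | inj₂ (c∈R-1 , p) =
          inj₁ (R ∸ 1 , R∸1<R , ≡⇒Adj* (sym (trans c≡first (cong first c∈R-1))) ◅◅ p)

  WalkInvariant-walk : ∀ {c w} → Star Poly c w → WalkInvariant c → WalkInvariant w
  WalkInvariant-walk ε        inv = inv
  WalkInvariant-walk (e ◅ es) inv = WalkInvariant-walk es (WalkInvariant-step e inv)

  some-sector-spanned : SomeSectorSpanned
  some-sector-spanned
    with WalkInvariant-walk (Poly-connected (first 0) (first 1) (first<N 0) (first<N 1))
                            (inj₂ (inj₁ (sector-first 0<R , ε)))
  ... | inj₁ spanned = spanned
  ... | inj₂ (inj₁ (1∈0 , _)) = contradiction (trans (sym (sector-first 1<R)) 1∈0) λ ()
  ... | inj₂ (inj₂ (1∈R-1 , p)) = 1 , 1<R , subst (λ t → Star Adj (first 1) (last t)) R-1≡1 p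
    where R-1≡1 = trans (sym 1∈R-1) (sector-first 1<R)

  offset : ℕ → ℕ → ℕ
  offset s t = t + (R ∸ s)

  [s+offset]%R≡t : ∀ {s t} → s ≤ R → t < R → (s + offset s t) % R ≡ t
  [s+offset]%R≡t {s} {t} s≤R t<R = begin
    (s + (t + (R ∸ s))) % R   ≡⟨ %-congˡ (+-assoc s t _) ⟨
    (s + t + (R ∸ s)) % R     ≡⟨ %-congˡ (cong (_+ (R ∸ s)) (+-comm s t)) ⟩
    (t + s + (R ∸ s)) % R     ≡⟨ %-congˡ (+-assoc t s _) ⟩
    (t + (s + (R ∸ s))) % R   ≡⟨ %-congˡ (cong (t +_) (m+[n∸m]≡n s≤R)) ⟩
    (t + R) % R               ≡⟨ [m+n]%n≡m%n t R ⟩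
    t % R                     ≡⟨ m<n⇒m%n≡m t<R ⟩
    t                         ∎
    where open ≡-Reasoning

  offset+offset : ∀ {s t} → s ≤ R → t ≤ R → offset s t + offset t s ≡ 2 * R
  offset+offset {s} {t} s≤R t≤R = begin
    (t + (R ∸ s)) + (s + (R ∸ t))   ≡⟨ swap t (R ∸ s) s (R ∸ t) ⟩
    (s + (R ∸ s)) + (t + (R ∸ t))   ≡⟨ cong₂ _+_ (m+[n∸m]≡n s≤R) (m+[n∸m]≡n t≤R) ⟩
    R + R                           ≡⟨ cong (R +_) (+-identityʳ R) ⟨
    2 * R                           ∎
    where
    open ≡-Reasoning
    swap : ∀ w x y z → (w + x) + (y + z) ≡ (y + x) + (w + z)
    swap = solve 4 (λ w x y z → (w :+ x) :+ (y :+ z) := (y :+ x) :+ (w :+ z)) refl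

  shift-offset-first : ∀ {s t} → s < R → t < R → shift (offset s t) (first s) ≡ first t
  shift-offset-first s<R t<R = trans (shift-first _ s<R) (cong first ([s+offset]%R≡t (<⇒≤ s<R) t<R))

  shift-offset-last : ∀ {s t} → s < R → t < R → shift (offset s t) (last s) ≡ last t
  shift-offset-last s<R t<R = trans (shift-last _ s<R) (cong last ([s+offset]%R≡t (<⇒≤ s<R) t<R))

  shift-offset-inverse : ∀ {s t} → s < R → t < R →
                         ∀ {m} → m < N → shift (offset t s) (shift (offset s t) m) ≡ m
  shift-offset-inverse {s} {t} s<R t<R {m} m<N = begin
    shift (offset t s) (shift (offset s t) m)   ≡⟨ shift-shift (offset t s) (offset s t) m ⟩
    shift (offset s t + offset t s) m
      ≡⟨ cong (λ n → shift n m) (offset+offset (<⇒≤ s<R) (<⇒≤ t<R)) ⟩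
    shift (2 * R) m                             ≡⟨ shift-*R 2 m<N ⟩
    m                                           ∎
    where open ≡-Reasoning

  every-sector-spanned : ∀ {t} → t < R → Star Adj (first t) (last t)
  every-sector-spanned {t} t<R with some-sector-spanned
  ... | (s , s<R , p) = subst₂ (Star Adj) (shift-offset-first s<R t<R) (shift-offset-last s<R t<R)
                                          (shift-Adj* (offset s t) p)

  Adj*-first⇒≡ : ∀ {s t} → s < R → t < R → Star Adj (first s) (first t) → s ≡ t
  Adj*-first⇒≡ s<R t<R p = trans (sym (sector-first s<R)) (trans (Adj*-sector p) (sector-first t<R))

  component-iso : ∀ {s t} → s < R → t < R → CompIso N Adj (first s) (first t)
  component-iso {s} {t} s<R t<R = record
    { to       = shift (offset s t)
    ; from     = shift (offset t s)
    ; to-mem   = λ m _ p → shift<N _ m , subst (Star Adj _) (shift-offset-first s<R t<R)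
                                                            (shift-Adj* (offset s t) p)
    ; from-mem = λ m _ p → shift<N _ m , subst (Star Adj _) (shift-offset-first t<R s<R)
                                                            (shift-Adj* (offset t s) p)
    ; from-to  = λ m m<N _ → shift-offset-inverse s<R t<R m<N
    ; to-from  = λ m m<N _ → shift-offset-inverse t<R s<R m<N
    ; adj      = λ m m′ m<N m′<N _ _ → mk⇔ (shift-Adj (offset s t))
                   (λ e → subst₂ Adj (shift-offset-inverse s<R t<R m<N)
                                     (shift-offset-inverse s<R t<R m′<N)
                                     (shift-Adj (offset t s) e))
    }

  exactly-R-isomorphic-components : ExactlyRIsoComponents N Adj R
  exactly-R-isomorphic-components =
      (λ connected → contradiction (Adj*-first⇒≡ 0<R 1<R (connected _ _ (first<N 0) (first<N 1))) λ ())
    , representative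
    , (λ t → first<N (toℕ t))
    , (λ t t′ p → toℕ-injective (Adj*-first⇒≡ (toℕ<n t) (toℕ<n t′) p))
    , joined-to-representative
    , (λ t t′ → component-iso (toℕ<n t) (toℕ<n t′))
    where
    representative : Fin R → ℕ
    representative t = first (toℕ t)

    joined-to-representative : ∀ m → m < N → Σ (Fin R) λ t → Star Adj m (representative t)
    joined-to-representative m m<N =
      fromℕ< (sector<R m) , subst (Star Adj m ∘ first) (sym (toℕ-fromℕ< (sector<R m))) joined
      where
      joined : Star Adj m (first (sector m))
      joined with joined-to-end m m<N
      ... | inj₁ p = p
      ... | inj₂ p = p ◅◅ Adj*-sym (every-sector-spanned (sector<R m))

-- The polymer graph with the cut removed

module CutGraph
  (π : Ordering) (P : Periodicity π) (S : SecStr) (R : ℕ) (1<R : 1 < R)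
  (S-wf : IsSecStr π S) (Poly-connected : IsConnectedStr π S)
  (H : Subset (Periodicity.v P)) (gen : Generator (Periodicity.v P) H) (∣H∣≡R : ∣ H ∣ ≡ R)
  (b : ℕ) (b-bond : IsBond π b) (admissible : Admissible π P S H b)
  (g : Fin (Periodicity.v P)) (g≡d : toℕ g ≡ Generator.d gen) (g-symmetry : Invariant π P S g)
  where

  open Periodicity P
  open Generator gen

  N Y D : ℕ
  N = nBases π
  Y = nBases fund
  D = d * Y

  R*d≡v : R * d ≡ v
  R*d≡v = trans (cong (_* d) (sym ∣H∣≡R)) ∣H∣*d≡v

  N≡R*D : N ≡ R * D
  N≡R*D = begin
    nBases π                           ≡⟨ cong nBases rep ⟩
    nBases (concat (replicate v fund)) ≡⟨ nBases-replicate v fund ⟩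
    v * Y                              ≡⟨ cong (_* Y) R*d≡v ⟨
    R * d * Y                          ≡⟨ *-assoc R d Y ⟩
    R * D                              ∎
    where open ≡-Reasoning

  bond<N : ∀ {k} → IsBond π k → suc k < N
  bond<N = IsBond⇒suc<nBases π _

  instance
    N≢0 : NonZero N
    N≢0 = >-nonZero (<-trans z<s (bond<N b-bond))
    R≢0 : NonZero R
    R≢0 = >-nonZero (<-trans z<s 1<R)
    D≢0 : NonZero D
    D≢0 = m*n≢0⇒n≢0 R {{subst NonZero N≡R*D N≢0}}

  open Sectors N R D N≡R*D b (<-trans (n<1+n b) (bond<N b-bond))

  bond-+copy : ∀ {k} → IsBond π k → IsBond π ((k + Y) % N)
  bond-+copy {k} bond = subst (IsBond π) (mod≡% (k + Y) N)
    (subst (λ π′ → IsBond π′ ((k + Y) mod nBases π′)) (sym rep)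
           (IsBond-shift-copy v fund k (subst (λ π′ → IsBond π′ k) rep bond)))

  bond-+copies : ∀ m {k} → IsBond π k → IsBond π ((k + m * Y) % N)
  bond-+copies zero {k} bond = subst (IsBond π) (begin
    k                 ≡⟨ m<n⇒m%n≡m (<-trans (n<1+n k) (bond<N bond)) ⟨
    k % N             ≡⟨ %-congˡ (+-identityʳ k) ⟨
    (k + 0) % N       ∎) bond
    where open ≡-Reasoning
  bond-+copies (suc m) {k} bond = subst (IsBond π) (begin
    ((k + m * Y) % N + Y) % N   ≡⟨ [m%n+o]%n≡[m+o]%n (k + m * Y) Y N ⟩
    (k + m * Y + Y) % N         ≡⟨ %-congˡ (+-assoc k (m * Y) Y) ⟩
    (k + (m * Y + Y)) % N       ≡⟨ %-congˡ (cong (k +_) (+-comm (m * Y) Y)) ⟩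
    (k + (Y + m * Y)) % N       ∎) (bond-+copy (bond-+copies m bond))
    where open ≡-Reasoning

  shift-bond : ∀ n {k} → IsBond π k → IsBond π (shift n k)
  shift-bond n {k} bond =
    subst (λ c → IsBond π ((k + c) % N)) (*-assoc n d Y) (bond-+copies (n * d) bond)

  rot≡shift : ∀ {e : Fin v} j → toℕ e ≡ j * d → ∀ m → rot π P e m ≡ shift j m
  rot≡shift {e} j e≡j*d m = trans (mod≡% _ N) (%-congˡ (cong (m +_) (begin
    toℕ e * Y     ≡⟨ cong (_* Y) e≡j*d ⟩
    j * d * Y     ≡⟨ *-assoc j d Y ⟩
    j * D         ∎)))
    where open ≡-Reasoning

  InCut⇒Boundary : ∀ {x} → suc x < N → InCut π P H b x → Boundary x
  InCut⇒Boundary {x} sx<N (e , e∈H , x≡rot) with Equivalence.to (∈⇔d∣ e) e∈H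
  ... | divides j e≡j*d =
    subst Boundary (sym x≡shift) (Boundary-shift-b j (subst (λ y → suc y < N) x≡shift sx<N))
    where
    x≡shift : x ≡ shift j b
    x≡shift = trans x≡rot (rot≡shift j e≡j*d b)

  Boundary⇒InCut : ∀ {x} → suc x < N → Boundary x → InCut π P H b x
  Boundary⇒InCut {x} sx<N bd = e , Equivalence.from (∈⇔d∣ e) (divides j e≡j*d) , x≡rot
    where
    open ≡-Reasoning
    j = sector (suc x)
    j*d<v : j * d < v
    j*d<v = subst (j * d <_) R*d≡v (*-monoˡ-< d (sector<R (suc x)))
    e = fromℕ< j*d<v
    e≡j*d = toℕ-fromℕ< j*d<v
    x≡rot : x ≡ rot π P e b
    x≡rot = suc-injective (begin
      suc x                    ≡⟨ m<n⇒m%n≡m sx<N ⟨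
      suc x % N                ≡⟨ Boundary⇒≡shift-b bd ⟩
      suc (shift j b) % N      ≡⟨ m<n⇒m%n≡m (bond<N (shift-bond j b-bond)) ⟩
      suc (shift j b)          ≡⟨ cong suc (rot≡shift j e≡j*d b) ⟨
      suc (rot π P e b)        ∎)

  -- A boundary at the nick between N ∸ 1 and 0 would make N ∸ 1 a shifted copy of the bond b.
  sector-nick : sector (N ∸ 1) ≡ sector 0
  sector-nick = begin
    sector (N ∸ 1)           ≡⟨ sector-suc ¬boundary ⟨
    sector (suc (N ∸ 1))     ≡⟨ cong sector (suc-pred N) ⟩
    sector N                 ≡⟨ /-congˡ pos-N≡pos-0 ⟩
    sector 0                 ∎
    where
    open ≡-Reasoning
    j = sector (suc (N ∸ 1))
    pos-N≡pos-0 : pos N ≡ pos 0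
    pos-N≡pos-0 = trans (%-congˡ (+-comm N (N ∸ suc b))) ([m+n]%n≡m%n (N ∸ suc b) N)
    ¬boundary : ¬ Boundary (N ∸ 1)
    ¬boundary bd = 0≢1+n (begin
      0                        ≡⟨ n%n≡0 N ⟨
      N % N                    ≡⟨ %-congˡ (suc-pred N) ⟨
      suc (N ∸ 1) % N          ≡⟨ Boundary⇒≡shift-b bd ⟩
      suc (shift j b) % N      ≡⟨ m<n⇒m%n≡m (bond<N (shift-bond j b-bond)) ⟩
      suc (shift j b)          ∎)

  sector-change⇒InCut : ∀ {x} → suc x < N → sector x ≢ sector (suc x) → InCut π P H b x
  sector-change⇒InCut {x} sx<N change with boundary? x
  ... | yes bd  = Boundary⇒InCut sx<N bd
  ... | no ¬bd = contradiction (sym (sector-suc ¬bd)) change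

  BP<N : ∀ {i j} → BP S i j → i < N × j < N
  BP<N {i} {j} (inj₁ ij∈S) = let (i<N , j<N , _) = proj₁ S-wf i j ij∈S in i<N , j<N
  BP<N {i} {j} (inj₂ ji∈S) = let (j<N , i<N , _) = proj₁ S-wf j i ji∈S in i<N , j<N

  sector-constant-on-arc : ∀ {i j lo hi} → BP S i j → lo ≤ hi → hi < N →
    (∀ m → lo ≤ m → m ≤ hi → InShortArc π P i j m) → sector lo ≡ sector hi
  sector-constant-on-arc {i} {j} {lo} {hi} bp lo≤hi hi<N on-arc with sector lo ≟ sector hi
  ... | yes same = same
  ... | no differ with change-point sector lo≤hi differ
  ...   | (x , lo≤x , x<hi , change) = contradiction
          (on-arc x lo≤x (<⇒≤ x<hi) , on-arc (suc x) (m≤n⇒m≤1+n lo≤x) x<hi)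
          (admissible x i j (sector-change⇒InCut (≤-<-trans x<hi hi<N) change) bp)

  -- The long arc of a chord runs through the nick, which is not a sector boundary.
  BP-sector-⊓⊔ : ∀ {i j} → BP S i j → sector (i ⊓ j) ≡ sector (i ⊔ j)
  BP-sector-⊓⊔ {i} {j} bp with ∣ i - j ∣ + 1 ≤? N ∸ ∣ i - j ∣ + 1
  ... | yes short = sector-constant-on-arc bp (m⊓n≤m⊔n i j) hi<N
          (λ m lo≤m m≤hi → ≤-<-trans m≤hi hi<N , inj₁ (short , lo≤m , m≤hi))
    where hi<N = ⊔-lub (proj₁ (BP<N bp)) (proj₂ (BP<N bp))
  ... | no long = begin
    sector (i ⊓ j)   ≡⟨ sector-constant-on-arc bp z≤n lo<N below-lo ⟨
    sector 0         ≡⟨ sector-nick ⟨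
    sector (N ∸ 1)   ≡⟨ sector-constant-on-arc bp (suc[m]≤n⇒m≤pred[n] hi<N) N∸1<N above-hi ⟨
    sector (i ⊔ j)   ∎
    where
    open ≡-Reasoning
    hi<N = ⊔-lub (proj₁ (BP<N bp)) (proj₂ (BP<N bp))
    lo<N = ≤-<-trans (m⊓n≤m⊔n i j) hi<N
    N∸1<N = ∸-monoʳ-< z<s (≤-<-trans z≤n hi<N)
    below-lo : ∀ m → 0 ≤ m → m ≤ i ⊓ j → InShortArc π P i j m
    below-lo m _ m≤lo = ≤-<-trans m≤lo lo<N , inj₂ (≰⇒> long , inj₁ m≤lo)
    above-hi : ∀ m → i ⊔ j ≤ m → m ≤ N ∸ 1 → InShortArc π P i j m
    above-hi m hi≤m m≤N-1 = m≤pred[n]⇒suc[m]≤n m≤N-1 , inj₂ (≰⇒> long , inj₂ hi≤m)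

  BP-sector : ∀ {i j} → BP S i j → sector i ≡ sector j
  BP-sector {i} {j} bp with ≤-total i j
  ... | inj₁ i≤j = subst₂ (λ lo hi → sector lo ≡ sector hi)
                          (m≤n⇒m⊓n≡m i≤j) (m≤n⇒m⊔n≡n i≤j) (BP-sector-⊓⊔ bp)
  ... | inj₂ j≤i = sym (subst₂ (λ lo hi → sector lo ≡ sector hi)
                               (m≥n⇒m⊓n≡n j≤i) (m≥n⇒m⊔n≡m j≤i) (BP-sector-⊓⊔ bp))

  shift-BP : ∀ n {i j} → BP S i j → BP S (shift n i) (shift n j)
  shift-BP zero {i} {j} bp =
    subst₂ (BP S) (sym (shift-*R 0 (proj₁ (BP<N bp)))) (sym (shift-*R 0 (proj₂ (BP<N bp)))) bp
  shift-BP (suc n) {i} {j} bp =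
    subst₂ (BP S) (rot-g∘shift i) (rot-g∘shift j)
      (Equivalence.to (g-symmetry (shift n i) (shift n j) (shift<N n i) (shift<N n j)) (shift-BP n bp))
    where
    rot-g∘shift : ∀ m → rot π P g (shift n m) ≡ shift (suc n) m
    rot-g∘shift m = trans (rot≡shift 1 (trans g≡d (sym (*-identityˡ d))) (shift n m))
                          (trans (shift-shift 1 n m) (cong (λ c → shift c m) (+-comm n 1)))

  Adj Poly : ℕ → ℕ → Set
  Adj  = CutAdj π P S H b
  Poly = PolyAdj π S

  InCut⇒sector-change : ∀ {k} → suc k < N → InCut π P H b k → sector k ≢ sector (suc k)
  InCut⇒sector-change {k} sk<N cut same = suc[m]%n≢m (sector k) R 1<R (begin
    suc (sector k) % R   ≡⟨ Boundary⇒sector-suc (InCut⇒Boundary sk<N cut) ⟨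
    sector (suc k)       ≡⟨ same ⟨
    sector k             ∎)
    where open ≡-Reasoning

  bond-sector : ∀ {k} → IsBond π k → ¬ InCut π P H b k → sector k ≡ sector (suc k)
  bond-sector {k} bond uncut with sector k ≟ sector (suc k)
  ... | yes same  = same
  ... | no change = contradiction (sector-change⇒InCut (bond<N bond) change) uncut

  bond-across : ∀ {k} → IsBond π k → sector k ≢ sector (suc k) →
    k ≡ last (sector k) × suc k ≡ first (sector (suc k)) × sector (suc k) ≡ suc (sector k) % R
  bond-across {k} bond change with boundary? k
  ... | yes bd  = Boundary⇒≡last (<-trans (n<1+n k) (bond<N bond)) bd ,
                  Boundary⇒suc≡first (bond<N bond) bd ,
                  Boundary⇒sector-suc bd
  ... | no ¬bd = contradiction (sym (sector-suc ¬bd)) change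

  Adj-sym : ∀ {i j} → Adj i j → Adj j i
  Adj-sym (inj₁ (k , bond , uncut , inj₁ ends)) = inj₁ (k , bond , uncut , inj₂ ends)
  Adj-sym (inj₁ (k , bond , uncut , inj₂ ends)) = inj₁ (k , bond , uncut , inj₁ ends)
  Adj-sym (inj₂ (inj₁ ij∈S)) = inj₂ (inj₂ ij∈S)
  Adj-sym (inj₂ (inj₂ ji∈S)) = inj₂ (inj₁ ji∈S)

  Adj-sector : ∀ {i j} → Adj i j → sector i ≡ sector j
  Adj-sector (inj₁ (k , bond , uncut , inj₁ (refl , refl))) = bond-sector bond uncut
  Adj-sector (inj₁ (k , bond , uncut , inj₂ (refl , refl))) = sym (bond-sector bond uncut)
  Adj-sector (inj₂ bp) = BP-sector bp

  Poly-sector : ∀ {i j} → Poly i j → sector i ≡ sector j → Adj i j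
  Poly-sector (inj₁ (k , bond , _ , inj₁ (refl , refl))) same =
    inj₁ (k , bond , (λ cut → InCut⇒sector-change (bond<N bond) cut same) , inj₁ (refl , refl))
  Poly-sector (inj₁ (k , bond , _ , inj₂ (refl , refl))) same =
    inj₁ (k , bond , (λ cut → InCut⇒sector-change (bond<N bond) cut (sym same)) , inj₂ (refl , refl))
  Poly-sector (inj₂ bp) _ = inj₂ bp

  Poly-across : ∀ {i j} → Poly i j → sector i ≢ sector j →
     (i ≡ last (sector i) × j ≡ first (sector j) × sector j ≡ suc (sector i) % R) ⊎
     (i ≡ first (sector i) × j ≡ last (sector j) × sector i ≡ suc (sector j) % R)
  Poly-across (inj₁ (k , bond , _ , inj₁ (refl , refl))) change = inj₁ (bond-across bond change)
  Poly-across (inj₁ (k , bond , _ , inj₂ (refl , refl))) change =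
    let (k≡last , sk≡first , next) = bond-across bond (change ∘ sym)
    in  inj₂ (sk≡first , k≡last , next)
  Poly-across (inj₂ bp) change = contradiction (BP-sector bp) change

  shift-uncut : ∀ n {k} → IsBond π k → ¬ InCut π P H b k → ¬ InCut π P H b (shift n k)
  shift-uncut n bond uncut cut =
    uncut (Boundary⇒InCut (bond<N bond) (Boundary-shift⁻ n sk<N (InCut⇒Boundary sk<N cut)))
    where sk<N = bond<N (shift-bond n bond)

  shift-suc-bond : ∀ n {k} → IsBond π k → shift n (suc k) ≡ suc (shift n k)
  shift-suc-bond n bond = shift-suc n (bond<N (shift-bond n bond))

  shift-Adj : ∀ n {i j} → Adj i j → Adj (shift n i) (shift n j)
  shift-Adj n (inj₁ (k , bond , uncut , inj₁ (refl , refl))) =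
    inj₁ (shift n k , shift-bond n bond , shift-uncut n bond uncut ,
          inj₁ (refl , shift-suc-bond n bond))
  shift-Adj n (inj₁ (k , bond , uncut , inj₂ (refl , refl))) =
    inj₁ (shift n k , shift-bond n bond , shift-uncut n bond uncut ,
          inj₂ (refl , shift-suc-bond n bond))
  shift-Adj n (inj₂ bp) = inj₂ (shift-BP n bp)

  exactly-R-isomorphic-components : ExactlyRIsoComponents N Adj R
  exactly-R-isomorphic-components = SectorGraph.exactly-R-isomorphic-components N R 1<R Adj Poly
    sector sector<R first last first<N sector-first
    Adj-sym Adj-sector Poly-connected Poly-sector Poly-across
    shift shift<N shift-Adj shift-shift shift-*R shift-first shift-last

-- The symmetry group of S is, like H, a subgroup of ℤ/v of order R, hence also dℤ/v.
generator-symmetry : ∀ {π} {P : Periodicity π} {S R} {H : Subset (Periodicity.v P)} → 1 < R →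
  RFoldSymmetric π P S R → (gen : Generator (Periodicity.v P) H) → ∣ H ∣ ≡ R →
  Σ (Fin (Periodicity.v P)) λ g → toℕ g ≡ Generator.d gen × Invariant π P S g
generator-symmetry {P = P} {R = R} 1<R (H₀ , H₀≤ , H₀-symmetric , ∣H₀∣≡R , _) gen ∣H∣≡R =
  g , toℕ-fromℕ< d<v , H₀-symmetric g g∈H₀
  where
  open Periodicity P using (v)
  open Generator gen
  module G₀ = Generator (subgroup-generator H₀≤ (subst (2 ≤_) (sym ∣H₀∣≡R) 1<R))
  instance
    R≢0 : NonZero R
    R≢0 = >-nonZero (<-trans z<s 1<R)
  R*d≡v : R * d ≡ v
  R*d≡v = trans (cong (_* d) (sym ∣H∣≡R)) ∣H∣*d≡v
  R*d₀≡v : R * G₀.d ≡ v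
  R*d₀≡v = trans (cong (_* G₀.d) (sym ∣H₀∣≡R)) G₀.∣H∣*d≡v
  d<v : d < v
  d<v = subst (d <_) (trans (*-comm d R) R*d≡v) (m<m*n d R 1<R)
  g = fromℕ< d<v
  g≡1*d₀ : toℕ g ≡ 1 * G₀.d
  g≡1*d₀ = trans (toℕ-fromℕ< d<v)
                 (trans (*-cancelˡ-≡ d G₀.d R (trans R*d≡v (sym R*d₀≡v))) (sym (*-identityˡ G₀.d)))
  g∈H₀ : g ∈ H₀
  g∈H₀ = Equivalence.from (G₀.∈⇔d∣ g) (divides 1 g≡1*d₀)

lemma3 : (π : Ordering) (P : Periodicity π) (S : SecStr) (R : ℕ) →
           2 ≤ R →
           IsSecStr π S →
           RFoldSymmetric π P S R →
           IsConnectedStr π S →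
           Unpseudoknotted S →
           (H : Subset (Periodicity.v P)) → IsSubgroup π P H → ∣ H ∣ ≡ R →
           (b : ℕ) → IsBond π b →
           Admissible π P S H b →
           ExactlyRIsoComponents (nBases π) (CutAdj π P S H b) R
lemma3 π P S R 1<R S-wf symmetric connected _ H H≤ ∣H∣≡R b b-bond admissible =
  let gen = subgroup-generator H≤ (subst (2 ≤_) (sym ∣H∣≡R) 1<R)
      (g , g≡d , g-symmetry) = generator-symmetry {P = P} 1<R symmetric gen ∣H∣≡R
  in CutGraph.exactly-R-isomorphic-components π P S R 1<R S-wf connected
       H gen ∣H∣≡R b b-bond admissible g g≡d g-symmetry
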